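{- Let $n\geq 4$ be even and let $u$ be an edgeword over $A_n=\{0,2,\dots,n-2\}$. Then the expansion matrix $M$ of $u$ is the $n\times n$ matrix with entries $M_{a,b}=m_{a-b}$ if $a\geq b$ and $M_{a,b}=-m_{a-b+n}$ if $a<b$ ($0\le a,b<n$), where $m_0=[u]_0$, $m_{n/2}=0$, and $m_i=[u]_i$, $m_{n-i}=-[u]_i$ for $1\leq i<\frac n2$. (In particular $M$ is pseudo-circulant with first row $(m_0,-m_{n-1},\dots,-m_1)$.)
   Context: Let $v_j=e^{\mathbf{i} j\pi/n}\in\mathbb{C}\cong\mathbb{R}^2$ for $0\le j\le n-1$, and let $(e_j)_{0\le j<n}$ be the canonical basis of $\mathbb{R}^n$. An edgeword is a finite palindromic word $u$ over $A_n$; its abelianization is $[u]\in\mathbb{Z}^{n/2}$ with $[u]_i=|u|_{2i}$ (number of occurrences of the letter $2i$), $0\le i<\frac n2$. A letter $0$ represents a unit edge along a side, a letter $2m$ ($m\ge1$) a rhombus of angle $2m\pi/n$ bisected by the side through its two vertices of angle $2m\pi/n$. For a unit direction $d\in\{\pm v_j\}$, the side path of $u$ in direction $d$ is obtained by reading $u$ from left to right, a letter $0$ contributing the step $d$ and a letter $2m$ contributing the two steps $d e^{\mathbf{i}m\pi/n}$ and $d e^{ -\mathbf{i}m\pi/n}$; every step is of the form $\pm v_l$. The lift of a step $\pm v_l$ is $\pm e_l\in\mathbb{Z}^n$, and the lift of a path is the sum of the lifts of its steps. The expansion matrix of $u$ is the $n\times n$ matrix whose $j$-th column ($0\le j<n$)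 is the lift of the side path of $u$ in direction $v_j$ (equivalently, the matrix of the lifted expansion of a substitution in which every edge is replaced by the edgeword $u$). A matrix $(M_{a,b})$ is pseudo-circulant if $M_{a,b}=M_{a',b'}$ whenever $a-b=a'-b'$ and $M_{a,b}=-M_{a',b'}$ whenever $a-b=a'-b'\pm n$. -}

module Defs where

open import Data.Nat as ℕ using (ℕ; zero; suc; _≤_; _<_; _≟_; _<?_; _≤?_; NonZero)
open import Data.Nat.DivMod using (_/_; _%_)
open import Data.Integer as ℤ using (ℤ; +_; -_; 0ℤ; 1ℤ)
open import Data.Fin using (Fin; toℕ)
open import Data.List using (List; []; _∷_; map; upTo; reverse; filter; length; concatMap; foldr)
open import Data.List.Membership.Propositional using (_∈_)
open import Data.List.Relation.Unary.All using (All)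
open import Data.Bool using (if_then_else_)
open import Relation.Nullary using (does)
open import Relation.Binary.PropositionalEquality using (_≡_)

A : ℕ → List ℕ
A n = map (2 ℕ.*_) (upTo (n / 2))

IsEdgeword : ℕ → List ℕ → Set
IsEdgeword n u = All (_∈ A n) u × reverse u ≡ u
  where open import Data.Product using (_×_)

occ : ℕ → List ℕ → ℕ
occ x u = length (filter (_≟ x) u)

abel : List ℕ → ℕ → ℕ
abel u i = occ (2 ℕ.* i) u

-- Unit directions of the form e^{i t π / n} are encoded by the angle index t : ℕ
-- (taken modulo 2n).  v_j has angle index j; -v_j has angle index j + n.
-- Multiplying by e^{± i m π / n} adds ± m to the angle index (we add 2n - m for -m).

-- Lift of a step e^{i t π/n} = ± v_{t mod n} to ±e_{t mod n} ∈ ℤ^n.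
liftStep : (n : ℕ) .{{_ : NonZero n}} → ℕ → Fin n → ℤ
liftStep n t l =
  if does (toℕ l ≟ t % n)
  then (if does ((t / n) % 2 ≟ 0) then 1ℤ else - 1ℤ)
  else 0ℤ

-- Side path of u in direction (angle index) d: list of angle indices of the steps.
-- Letter 0 gives the step d; letter 2m (m ≥ 1) gives d e^{i mπ/n}, d e^{-i mπ/n}.
sidePath : ℕ → List ℕ → ℕ → List ℕ
sidePath n u d = concatMap step u
  where
  step : ℕ → List ℕ
  step x = if does (x ≟ 0) then d ∷ []
           else (d ℕ.+ x / 2) ∷ (d ℕ.+ (2 ℕ.* n ℕ.∸ x / 2)) ∷ []

liftPath : (n : ℕ) .{{_ : NonZero n}} → List ℕ → Fin n → ℤ
liftPath n p l = foldr (λ t acc → liftStep n t l ℤ.+ acc) 0ℤ p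

expansionMatrix : (n : ℕ) .{{_ : NonZero n}} → List ℕ → Fin n → Fin n → ℤ
expansionMatrix n u a b = liftPath n (sidePath n u (toℕ b)) a

mseq : ℕ → List ℕ → ℕ → ℤ
mseq n u i =
  if does (i ≟ 0) then + abel u 0
  else if does (2 ℕ.* i ≟ n) then 0ℤ
  else if does (2 ℕ.* i <? n) then + abel u i
  else - (+ abel u (n ℕ.∸ i))

predictedMatrix : (n : ℕ) → List ℕ → Fin n → Fin n → ℤ
predictedMatrix n u a b =
  if does (toℕ b ≤? toℕ a) then mseq n u (toℕ a ℕ.∸ toℕ b)
  else - mseq n u (toℕ a ℕ.+ n ℕ.∸ toℕ b)

-- Both sides are additive in the word u: the expansion matrix because the lift of a
-- concatenation of paths is the sum of the lifts, the predicted matrix because it is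
-- linear in the abelianization [u].  It therefore suffices to treat one-letter words.
-- The step of angle index t lifts at coordinate k to [t = k] - [t = k + n] when
-- t < 2n, and the step t + n lifts to minus the step t; hence the pseudo-circulant
-- matrix of the unit sequence at p < n has column b equal to the lift of the step
-- b + p.  The letter 0 is the single step b and its sequence is the unit sequence
-- at 0; the rhombus letter 2m consists of the steps b + m and b + 2n - m, the latter
-- lifting to minus the step b + (n - m), and its sequence is the unit sequence at m
-- minus the unit sequence at n - m.
module Submission where

open import Defs
open import Data.Bool using (true; false; if_then_else_)
open import Data.Bool.Properties using (if-float)
open import Data.Fin using (Fin; toℕ)
open import Data.Fin.Properties using (toℕ<n)
open import Data.Integer as ℤ using (ℤ; -_; 0ℤ; 1ℤ)
import Data.Integer.Properties as ℤP
open import Data.List using (List; []; _∷_; [_]; _++_)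
open import Data.List.Properties using (++-identityʳ)
open import Data.List.Membership.Propositional using (_∈_)
open import Data.List.Membership.Propositional.Properties using (∈-map⁻; ∈-upTo⁻)
open import Data.List.Relation.Unary.All using (All; []; _∷_)
open import Data.Nat
open import Data.Nat.Properties
open import Data.Nat.DivMod
open import Data.Nat.Divisibility using (_∣_)
open import Data.Product using (_,_)
open import Function using (_∘_)
open import Relation.Nullary using (Dec; yes; no; does; ¬_; contradiction)
open import Relation.Binary.PropositionalEquality hiding ([_])

if-does : ∀ {a p} {A : Set a} {P : Set p} (P? : Dec P) {x y z : A} →
          (P → x ≡ z) → (¬ P → y ≡ z) → (if does P? then x else y) ≡ z
if-does (yes p) x≡z _ = x≡z p
if-does (no ¬p) _ y≡z = y≡z ¬p

δ : ℕ → ℕ → ℤ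
δ p q = if does (p ≟ q) then 1ℤ else 0ℤ

δ-≡ : ∀ {p q} → p ≡ q → δ p q ≡ 1ℤ
δ-≡ {p} {q} p≡q = if-does (p ≟ q) (λ _ → refl) (contradiction p≡q)

δ-≢ : ∀ {p q} → p ≢ q → δ p q ≡ 0ℤ
δ-≢ {p} {q} p≢q = if-does (p ≟ q) (λ p≡q → contradiction p≡q p≢q) (λ _ → refl)

δ-cong : ∀ {p q r s} → (p ≡ q → r ≡ s) → (r ≡ s → p ≡ q) → δ p q ≡ δ r s
δ-cong {p} {q} to from =
  if-does (p ≟ q) (λ p≡q → sym (δ-≡ (to p≡q))) (λ p≢q → sym (δ-≢ (p≢q ∘ from)))

δ-+ʳ : ∀ {p q} c → δ (p + c) (q + c) ≡ δ p q
δ-+ʳ {p} {q} c = δ-cong (+-cancelʳ-≡ c p q) (cong (_+ c))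

δ-*2 : ∀ p q → δ (2 * p) (2 * q) ≡ δ p q
δ-*2 p q = δ-cong (*-cancelˡ-≡ p q 2) (cong (2 *_))

δ-∸ : ∀ {p q r} → q ≤ r → δ p (r ∸ q) ≡ δ r (q + p)
δ-∸ {p} {q} {r} q≤r = δ-cong
  (λ p≡r∸q → trans (sym (m+[n∸m]≡n q≤r)) (cong (q +_) (sym p≡r∸q)))
  (λ r≡q+p → sym (trans (cong (_∸ q) r≡q+p) (m+n∸m≡n q p)))

δ-∸-swap : ∀ {m n i} → m ≤ n → i ≤ n → δ m (n ∸ i) ≡ δ (n ∸ m) i
δ-∸-swap {m} {n} {i} m≤n i≤n = δ-cong
  (λ m≡n∸i → trans (cong (n ∸_) m≡n∸i) (m∸[m∸n]≡n i≤n))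
  (λ n∸m≡i → trans (sym (m∸[m∸n]≡n m≤n)) (cong (n ∸_) n∸m≡i))

x-y≡x : ∀ {x y} → y ≡ 0ℤ → x ℤ.- y ≡ x
x-y≡x {x} refl = ℤP.+-identityʳ x

x-y≡-y : ∀ {x y} → x ≡ 0ℤ → x ℤ.- y ≡ - y
x-y≡-y {y = y} refl = ℤP.+-identityˡ (- y)

sgn : ℕ → ℤ
sgn q = if does (q % 2 ≟ 0) then 1ℤ else - 1ℤ

sgn-suc : ∀ q → sgn (suc q) ≡ - sgn q
sgn-suc zero    = refl
sgn-suc (suc q) = sym (trans (cong -_ (sgn-suc q)) (ℤP.neg-involutive (sgn q)))

2*m<n⇒m<n : ∀ {m n} → 2 * m < n → m < n
2*m<n⇒m<n {m} = ≤-<-trans (m≤m+n m (m + 0))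

Additive : (List ℕ → ℤ) → Set
Additive f = ∀ x u → f (x ∷ u) ≡ f [ x ] ℤ.+ f u

additive-ext : ∀ {P : ℕ → Set} (f g : List ℕ → ℤ) → Additive f → Additive g →
               f [] ≡ g [] → (∀ {x} → P x → f [ x ] ≡ g [ x ]) →
               ∀ {u} → All P u → f u ≡ g u
additive-ext f g _     _     f[]≡g[] _      []         = f[]≡g[]
additive-ext f g f-add g-add f[]≡g[] letter (px ∷ pu) = begin
  f (_ ∷ _)       ≡⟨ f-add _ _ ⟩
  f [ _ ] ℤ.+ f _ ≡⟨ cong₂ ℤ._+_ (letter px) (additive-ext f g f-add g-add f[]≡g[] letter pu) ⟩
  g [ _ ] ℤ.+ g _ ≡⟨ g-add _ _ ⟨
  g (_ ∷ _)       ∎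
  where open ≡-Reasoning

sidePath-∷ : ∀ n x u d → sidePath n (x ∷ u) d ≡ sidePath n [ x ] d ++ sidePath n u d
sidePath-∷ n x u d = cong (_++ sidePath n u d) (sym (++-identityʳ _))

module _ (n : ℕ) .{{n≢0 : NonZero n}} where

  liftStep-< : ∀ {t} (l : Fin n) → t < n → liftStep n t l ≡ δ (toℕ l) t
  liftStep-< {t} l t<n rewrite m<n⇒m%n≡m t<n | m<n⇒m/n≡0 t<n = refl

  liftStep-+n : ∀ t (l : Fin n) → liftStep n (t + n) l ≡ - liftStep n t l
  liftStep-+n t l
    rewrite [m+n]%n≡m%n t n {{n≢0}} | m/n≡1+[m∸n]/n (m≤n+m n t) | m+n∸n≡m t n =
    trans (cong (λ s → if does (toℕ l ≟ t % n) then s else 0ℤ) (sgn-suc (t / n)))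
          (sym (if-float -_ (does (toℕ l ≟ t % n))))

  liftStep-<2n : ∀ {t} (l : Fin n) → t < n + n →
                 liftStep n t l ≡ δ (toℕ l) t ℤ.- δ (toℕ l + n) t
  liftStep-<2n {t} l t<2n with t <? n
  ... | yes t<n = begin
    liftStep n t l                     ≡⟨ liftStep-< l t<n ⟩
    δ k t                              ≡⟨ x-y≡x (δ-≢ (>⇒≢ (<-≤-trans t<n (m≤n+m n k)))) ⟨
    δ k t ℤ.- δ (k + n) t              ∎
    where open ≡-Reasoning
          k = toℕ l
  ... | no t≮n = subst (λ t → liftStep n t l ≡ δ k t ℤ.- δ (k + n) t)
                       (m∸n+n≡m (≮⇒≥ t≮n)) (upper (t ∸ n) r<n)
    where
    open ≡-Reasoning
    k = toℕ l
    r<n : t ∸ n < n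
    r<n = +-cancelʳ-< n (t ∸ n) n (subst (_< n + n) (sym (m∸n+n≡m (≮⇒≥ t≮n))) t<2n)
    upper : ∀ r → r < n → liftStep n (r + n) l ≡ δ k (r + n) ℤ.- δ (k + n) (r + n)
    upper r r<n = begin
      liftStep n (r + n) l                 ≡⟨ liftStep-+n r l ⟩
      - liftStep n r l                     ≡⟨ cong -_ (liftStep-< l r<n) ⟩
      - δ k r                              ≡⟨ x-y≡-y (δ-≢ (<⇒≢ (<-≤-trans (toℕ<n l) (m≤n+m n r)))) ⟨
      δ k (r + n) ℤ.- δ k r                ≡⟨ cong (λ d → δ k (r + n) ℤ.- d) (δ-+ʳ {k} {r} n) ⟨
      δ k (r + n) ℤ.- δ (k + n) (r + n)    ∎

  liftPath-++ : ∀ p q (l : Fin n) → liftPath n (p ++ q) l ≡ liftPath n p l ℤ.+ liftPath n q l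
  liftPath-++ []      q l = sym (ℤP.+-identityˡ _)
  liftPath-++ (t ∷ p) q l =
    trans (cong (λ z → liftStep n t l ℤ.+ z) (liftPath-++ p q l))
          (sym (ℤP.+-assoc (liftStep n t l) (liftPath n p l) (liftPath n q l)))

  expansionMatrix-additive : (a b : Fin n) → Additive (λ u → expansionMatrix n u a b)
  expansionMatrix-additive a b x u =
    trans (cong (λ p → liftPath n p a) (sidePath-∷ n x u (toℕ b)))
          (liftPath-++ (sidePath n [ x ] (toℕ b)) (sidePath n u (toℕ b)) a)

  expansionMatrix-[0] : (a b : Fin n) → expansionMatrix n [ 0 ] a b ≡ liftStep n (toℕ b) a
  expansionMatrix-[0] a b = ℤP.+-identityʳ _

  expansionMatrix-rhombus : ∀ m → 2 * suc m < n → (a b : Fin n) →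
    expansionMatrix n [ 2 * suc m ] a b ≡
    liftStep n (toℕ b + suc m) a ℤ.- liftStep n (toℕ b + (n ∸ suc m)) a
  expansionMatrix-rhombus m 2m<n a b = begin
    liftStep n (j + h) a ℤ.+ (liftStep n (j + (2 * n ∸ h)) a ℤ.+ 0ℤ)
      ≡⟨ cong (λ h → liftStep n (j + h) a ℤ.+ (liftStep n (j + (2 * n ∸ h)) a ℤ.+ 0ℤ)) half ⟩
    liftStep n (j + m′) a ℤ.+ (liftStep n (j + (2 * n ∸ m′)) a ℤ.+ 0ℤ)
      ≡⟨ cong (λ z → liftStep n (j + m′) a ℤ.+ z) (ℤP.+-identityʳ _) ⟩
    liftStep n (j + m′) a ℤ.+ liftStep n (j + (2 * n ∸ m′)) a
      ≡⟨ cong (λ t → liftStep n (j + m′) a ℤ.+ liftStep n t a) wrap ⟩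
    liftStep n (j + m′) a ℤ.+ liftStep n (j + (n ∸ m′) + n) a
      ≡⟨ cong (λ z → liftStep n (j + m′) a ℤ.+ z) (liftStep-+n (j + (n ∸ m′)) a) ⟩
    liftStep n (j + m′) a ℤ.- liftStep n (j + (n ∸ m′)) a ∎
    where
    open ≡-Reasoning
    j = toℕ b
    m′ = suc m
    h = 2 * m′ / 2
    half : h ≡ m′
    half = trans (cong (_/ 2) (*-comm 2 m′)) (m*n/n≡m m′ 2)
    wrap : j + (2 * n ∸ m′) ≡ j + (n ∸ m′) + n
    wrap = trans (cong (λ x → j + (n + x ∸ m′)) (+-identityʳ n))
                 (trans (cong (j +_) (+-∸-comm {n} n {m′} (<⇒≤ (2*m<n⇒m<n 2m<n))))
                        (sym (+-assoc j (n ∸ m′) n)))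

pseudoCirculant : (n : ℕ) → (ℕ → ℤ) → Fin n → Fin n → ℤ
pseudoCirculant n s a b =
  if does (toℕ b ≤? toℕ a) then s (toℕ a ∸ toℕ b) else - s (toℕ a + n ∸ toℕ b)

module _ {n : ℕ} (a b : Fin n) where

  private
    k = toℕ a
    j = toℕ b

  pseudoCirculant-≤ : ∀ s → j ≤ k → pseudoCirculant n s a b ≡ s (k ∸ j)
  pseudoCirculant-≤ s j≤k = if-does (j ≤? k) (λ _ → refl) (contradiction j≤k)

  pseudoCirculant-> : ∀ s → k < j → pseudoCirculant n s a b ≡ - s (k + n ∸ j)
  pseudoCirculant-> s k<j = if-does (j ≤? k) (λ j≤k → contradiction j≤k (<⇒≱ k<j)) (λ _ → refl)

  pseudoCirculant-cong : ∀ s s′ → (∀ {i} → i < n → s i ≡ s′ i) →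
                         pseudoCirculant n s a b ≡ pseudoCirculant n s′ a b
  pseudoCirculant-cong s s′ s≗s′ = if-does (j ≤? k)
    (λ j≤k → trans (s≗s′ (≤-<-trans (m∸n≤m k j) (toℕ<n a))) (sym (pseudoCirculant-≤ s′ j≤k)))
    (λ j≰k → trans (cong -_ (s≗s′ (wrapped-< (≰⇒> j≰k))))
                   (sym (pseudoCirculant-> s′ (≰⇒> j≰k))))
    where
    wrapped-< : k < j → k + n ∸ j < n
    wrapped-< k<j = subst (k + n ∸ j <_) (m+n∸m≡n j n)
      (∸-monoˡ-< (+-monoˡ-< n k<j) (≤-trans (<⇒≤ (toℕ<n b)) (m≤n+m n k)))

  pseudoCirculant-+ : ∀ s s′ → pseudoCirculant n (λ i → s i ℤ.+ s′ i) a b ≡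
                              pseudoCirculant n s a b ℤ.+ pseudoCirculant n s′ a b
  pseudoCirculant-+ s s′ = if-does (j ≤? k)
    (λ j≤k → sym (cong₂ ℤ._+_ (pseudoCirculant-≤ s j≤k) (pseudoCirculant-≤ s′ j≤k)))
    (λ j≰k → trans (ℤP.neg-distrib-+ (s (k + n ∸ j)) (s′ (k + n ∸ j)))
      (sym (cong₂ ℤ._+_ (pseudoCirculant-> s (≰⇒> j≰k)) (pseudoCirculant-> s′ (≰⇒> j≰k)))))

  pseudoCirculant-neg : ∀ s → pseudoCirculant n (λ i → - s i) a b ≡ - pseudoCirculant n s a b
  pseudoCirculant-neg s = if-does (j ≤? k)
    (λ j≤k → cong -_ (sym (pseudoCirculant-≤ s j≤k)))
    (λ j≰k → cong -_ (sym (pseudoCirculant-> s (≰⇒> j≰k))))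

  pseudoCirculant-0 : pseudoCirculant n (λ _ → 0ℤ) a b ≡ 0ℤ
  pseudoCirculant-0 = if-does (j ≤? k) (λ _ → refl) (λ _ → refl)

  pseudoCirculant-δ : .{{_ : NonZero n}} → ∀ {p} → p < n →
                      pseudoCirculant n (δ p) a b ≡ liftStep n (j + p) a
  pseudoCirculant-δ {p} p<n with j ≤? k
  ... | yes j≤k = begin
    pseudoCirculant n (δ p) a b          ≡⟨ pseudoCirculant-≤ (δ p) j≤k ⟩
    δ p (k ∸ j)                          ≡⟨ δ-∸ j≤k ⟩
    δ k (j + p)                          ≡⟨ x-y≡x (δ-≢ (>⇒≢ (+-mono-≤-< j≤k p<n))) ⟨
    δ k (j + p) ℤ.- δ (k + n) (j + p)    ≡⟨ liftStep-<2n n a (+-mono-< (toℕ<n b) p<n) ⟨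
    liftStep n (j + p) a                 ∎
    where open ≡-Reasoning
  ... | no j≰k = begin
    pseudoCirculant n (δ p) a b          ≡⟨ pseudoCirculant-> (δ p) (≰⇒> j≰k) ⟩
    - δ p (k + n ∸ j)                    ≡⟨ cong -_ (δ-∸ (≤-trans (<⇒≤ (toℕ<n b)) (m≤n+m n k))) ⟩
    - δ (k + n) (j + p)                  ≡⟨ x-y≡-y (δ-≢ (<⇒≢ (<-≤-trans (≰⇒> j≰k) (m≤m+n j p)))) ⟨
    δ k (j + p) ℤ.- δ (k + n) (j + p)    ≡⟨ liftStep-<2n n a (+-mono-< (toℕ<n b) p<n) ⟨
    liftStep n (j + p) a                 ∎
    where open ≡-Reasoning

abel-[x] : ∀ x i → ℤ.+ abel [ x ] i ≡ δ x (2 * i)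
abel-[x] x i with x ≡ᵇ 2 * i
... | true  = refl
... | false = refl

abel-∷ : ∀ x u i → abel (x ∷ u) i ≡ abel [ x ] i + abel u i
abel-∷ x u i with x ≡ᵇ 2 * i
... | true  = refl
... | false = refl

mseq-[] : ∀ n i → mseq n [] i ≡ 0ℤ
mseq-[] n i with does (i ≟ 0) | does (2 * i ≟ n) | does (2 * i <? n)
... | true  | _     | _     = refl
... | false | true  | _     = refl
... | false | false | true  = refl
... | false | false | false = refl

mseq-∷ : ∀ n x u i → mseq n (x ∷ u) i ≡ mseq n [ x ] i ℤ.+ mseq n u i
mseq-∷ n x u i with does (i ≟ 0) | does (2 * i ≟ n) | does (2 * i <? n)
... | true  | _     | _     = cong ℤ.+_ (abel-∷ x u 0)
... | false | true  | _     = refl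
... | false | false | true  = cong ℤ.+_ (abel-∷ x u i)
... | false | false | false =
  trans (cong (-_ ∘ ℤ.+_) (abel-∷ x u (n ∸ i))) (ℤP.neg-distrib-+ (ℤ.+ abel [ x ] (n ∸ i)) _)

n<2*[n∸m] : ∀ {n m} → 2 * m < n → n < 2 * (n ∸ m)
n<2*[n∸m] {n} {m} 2m<n = begin-strict
  n                  ≡⟨ m∸n+n≡m m≤n ⟨
  (n ∸ m) + m        <⟨ +-monoʳ-< (n ∸ m) m<n∸m ⟩
  (n ∸ m) + (n ∸ m)  ≡⟨ cong ((n ∸ m) +_) (+-identityʳ (n ∸ m)) ⟨
  2 * (n ∸ m)        ∎
  where
  open ≤-Reasoning
  m≤n : m ≤ n
  m≤n = <⇒≤ (2*m<n⇒m<n 2m<n)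
  m<n∸m : m < n ∸ m
  m<n∸m = +-cancelʳ-< m m (n ∸ m)
    (subst₂ _<_ (cong (m +_) (+-identityʳ m)) (sym (m∸n+n≡m m≤n)) 2m<n)

n∸m≢i : ∀ {n} m i → 2 * m < n → 2 * i ≤ n → n ∸ m ≢ i
n∸m≢i {n} m _ 2m<n 2i≤n n∸m≡i =
  <⇒≱ (subst (λ x → n < 2 * x) n∸m≡i (n<2*[n∸m] {n} {m} 2m<n)) 2i≤n

m≢i : ∀ {n} m i → 2 * m < n → n ≤ 2 * i → m ≢ i
m≢i _ _ 2m<n n≤2i refl = <⇒≱ 2m<n n≤2i

mseq-[2m] : ∀ {n m i} → 2 * m < n → i < n → mseq n [ 2 * m ] i ≡ δ m i ℤ.- δ (n ∸ m) i
mseq-[2m] {n} {m} {zero} 2m<n _ = begin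
  ℤ.+ abel [ 2 * m ] 0    ≡⟨ abel-[x] (2 * m) 0 ⟩
  δ (2 * m) (2 * 0)       ≡⟨ δ-*2 m 0 ⟩
  δ m 0                   ≡⟨ x-y≡x (δ-≢ (n∸m≢i m 0 2m<n z≤n)) ⟨
  δ m 0 ℤ.- δ (n ∸ m) 0   ∎
  where open ≡-Reasoning
mseq-[2m] {n} {m} {i@(suc _)} 2m<n i<n = if-does (2 * i ≟ n)
  (λ 2i≡n → sym (cong₂ ℤ._-_ (δ-≢ (m≢i m i 2m<n (≤-reflexive (sym 2i≡n))))
                             (δ-≢ (n∸m≢i m i 2m<n (≤-reflexive 2i≡n)))))
  (λ _ → if-does (2 * i <? n) below (above ∘ ≮⇒≥))
  where
  open ≡-Reasoning
  below : 2 * i < n → ℤ.+ abel [ 2 * m ] i ≡ δ m i ℤ.- δ (n ∸ m) i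
  below 2i<n = begin
    ℤ.+ abel [ 2 * m ] i    ≡⟨ abel-[x] (2 * m) i ⟩
    δ (2 * m) (2 * i)       ≡⟨ δ-*2 m i ⟩
    δ m i                   ≡⟨ x-y≡x (δ-≢ (n∸m≢i m i 2m<n (<⇒≤ 2i<n))) ⟨
    δ m i ℤ.- δ (n ∸ m) i   ∎
  above : n ≤ 2 * i → - ℤ.+ abel [ 2 * m ] (n ∸ i) ≡ δ m i ℤ.- δ (n ∸ m) i
  above n≤2i = begin
    - ℤ.+ abel [ 2 * m ] (n ∸ i)  ≡⟨ cong -_ (abel-[x] (2 * m) (n ∸ i)) ⟩
    - δ (2 * m) (2 * (n ∸ i))     ≡⟨ cong -_ (δ-*2 m (n ∸ i)) ⟩
    - δ m (n ∸ i)                 ≡⟨ cong -_ (δ-∸-swap (<⇒≤ (2*m<n⇒m<n {m} 2m<n)) (<⇒≤ i<n)) ⟩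
    - δ (n ∸ m) i                 ≡⟨ x-y≡-y (δ-≢ (m≢i m i 2m<n n≤2i)) ⟨
    δ m i ℤ.- δ (n ∸ m) i         ∎

module _ (n : ℕ) .{{_ : NonZero n}} (a b : Fin n) where

  private
    j = toℕ b

  predictedMatrix-additive : Additive (λ u → predictedMatrix n u a b)
  predictedMatrix-additive x u =
    trans (pseudoCirculant-cong a b _ _ (λ {i} _ → mseq-∷ n x u i))
          (pseudoCirculant-+ a b (mseq n [ x ]) (mseq n u))

  predictedMatrix-[] : predictedMatrix n [] a b ≡ 0ℤ
  predictedMatrix-[] =
    trans (pseudoCirculant-cong a b (mseq n []) (λ _ → 0ℤ) (λ {i} _ → mseq-[] n i))
          (pseudoCirculant-0 a b)

  predictedMatrix-[0] : predictedMatrix n [ 0 ] a b ≡ liftStep n j a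
  predictedMatrix-[0] = begin
    predictedMatrix n [ 0 ] a b   ≡⟨ pseudoCirculant-cong a b (mseq n [ 0 ]) (δ 0) mseq-[0] ⟩
    pseudoCirculant n (δ 0) a b   ≡⟨ pseudoCirculant-δ a b 0<n ⟩
    liftStep n (j + 0) a          ≡⟨ cong (λ t → liftStep n t a) (+-identityʳ j) ⟩
    liftStep n j a                ∎
    where
    open ≡-Reasoning
    0<n : 0 < n
    0<n = >-nonZero⁻¹ n
    mseq-[0] : ∀ {i} → i < n → mseq n [ 0 ] i ≡ δ 0 i
    mseq-[0] i<n = trans (mseq-[2m] {m = 0} 0<n i<n) (x-y≡x (δ-≢ (>⇒≢ i<n)))

  predictedMatrix-rhombus : ∀ m → 2 * suc m < n →
    predictedMatrix n [ 2 * suc m ] a b ≡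
    liftStep n (j + suc m) a ℤ.- liftStep n (j + (n ∸ suc m)) a
  predictedMatrix-rhombus m 2m<n = begin
    predictedMatrix n [ 2 * suc m ] a b
      ≡⟨ pseudoCirculant-cong a b _ _ (mseq-[2m] {m = suc m} 2m<n) ⟩
    pseudoCirculant n (λ i → δ (suc m) i ℤ.- δ (n ∸ suc m) i) a b
      ≡⟨ pseudoCirculant-+ a b (δ (suc m)) (λ i → - δ (n ∸ suc m) i) ⟩
    pseudoCirculant n (δ (suc m)) a b ℤ.+ pseudoCirculant n (λ i → - δ (n ∸ suc m) i) a b
      ≡⟨ cong (λ z → pseudoCirculant n (δ (suc m)) a b ℤ.+ z)
              (pseudoCirculant-neg a b (δ (n ∸ suc m))) ⟩
    pseudoCirculant n (δ (suc m)) a b ℤ.- pseudoCirculant n (δ (n ∸ suc m)) a b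
      ≡⟨ cong₂ ℤ._-_ (pseudoCirculant-δ a b m<n) (pseudoCirculant-δ a b n∸m<n) ⟩
    liftStep n (j + suc m) a ℤ.- liftStep n (j + (n ∸ suc m)) a ∎
    where
    open ≡-Reasoning
    m<n : suc m < n
    m<n = 2*m<n⇒m<n 2m<n
    n∸m<n : n ∸ suc m < n
    n∸m<n = ∸-monoʳ-< z<s (<⇒≤ m<n)

  letter-entry : ∀ {x} → x ∈ A n → expansionMatrix n [ x ] a b ≡ predictedMatrix n [ x ] a b
  letter-entry x∈A with ∈-map⁻ (2 *_) x∈A
  ... | zero  , _   , refl = trans (expansionMatrix-[0] n a b) (sym predictedMatrix-[0])
  ... | suc m , m∈ , refl =
    trans (expansionMatrix-rhombus n m 2m<n a b) (sym (predictedMatrix-rhombus m 2m<n))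
    where
    2m<n : 2 * suc m < n
    2m<n = subst (_< n) (*-comm (suc m) 2) (<-≤-trans (*-monoˡ-< 2 (∈-upTo⁻ m∈)) (m/n*n≤m n 2))

mainTheorem3 : (n : ℕ) .{{_ : NonZero n}} → 4 ≤ n → 2 ∣ n →
    (u : List ℕ) → IsEdgeword n u →
    (a b : Fin n) → expansionMatrix n u a b ≡ predictedMatrix n u a b
mainTheorem3 n _ _ u (u∈A* , _) a b =
  additive-ext (λ w → expansionMatrix n w a b) (λ w → predictedMatrix n w a b)
    (expansionMatrix-additive n a b) (predictedMatrix-additive n a b)
    (sym (predictedMatrix-[] n a b)) (letter-entry n a b) u∈A*
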